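{- Let $n,k$ be positive integers and $s_1,s_2,t_1,t_2 \in \mathbb{Z}_k$ with $t_1\neq 0$, $t_2 \neq 0$, $t_1\neq t_2$. Suppose that none of the following holds: (i) $s_1-s_2\equiv t_1 \pmod k$; (ii) $s_2-s_1\equiv t_2 \pmod k$; (iii) $s_1-s_2\equiv t_1-t_2 \pmod k$. Then no vertex of $Y(s_1,t_1)$ is adjacent in $H(n,k)$ to any vertex of $Y(s_2,t_2)$.
   Context: The Hamming graph $H(n,k)$ has vertex set $\mathbb{Z}_k^n$ with $\mathbb{Z}_k=\{0,1,\dots,k-1\}$, two vertices being adjacent iff they differ in exactly one coordinate; $v(i)$ is the $i$-th coordinate of $v$ and arithmetic is modulo $k$. For $v \neq (0,\dots,0)$, $\ell(v)$ is the largest index $i$ with $v(i)\neq 0$. For $s,t\in\mathbb{Z}_k$ with $t\neq 0$, $Y(s,t)$ is the set of nonzero vertices $v$ with $\sum_{i=1}^n v(i)\equiv s \pmod k$ and $v(\ell(v)) = t$. -}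

module Defs where

open import Data.Nat using (ℕ; zero; suc; _+_; _%_)
open import Data.Fin using (Fin; toℕ; _<_)
import Data.Fin as F
open import Data.Product using (Σ; ∃; _×_; _,_)
open import Relation.Binary.PropositionalEquality using (_≡_; _≢_)
open import Relation.Nullary using (¬_)

-- Z_k is represented by Fin k (k positive, written k = suc m); 0 is F.zero.
-- Vertices of H(n,k): functions Fin n → Fin k (coordinates indexed 0..n-1).
Vertex : ℕ → ℕ → Set
Vertex n k = Fin n → Fin k

ModEq : ℕ → ℕ → ℕ → Set
ModEq zero a b = a ≡ b
ModEq (suc m) a b = a % suc m ≡ b % suc m

Adjacent : ∀ {n k} → Vertex n k → Vertex n k → Set
Adjacent {n} u w = Σ (Fin n) λ i → (u i ≢ w i) × (∀ j → j ≢ i → u j ≡ w j)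

IsZeroVertex : ∀ {n k} → Vertex (n) (suc k) → Set
IsZeroVertex {n} v = ∀ i → v i ≡ F.zero

coordSum : ∀ n {k} → Vertex n k → ℕ
coordSum zero v = 0
coordSum (suc n) v = toℕ (v F.zero) + coordSum n (λ i → v (F.suc i))

IsLast : ∀ {n k} → Vertex n (suc k) → Fin n → Set
IsLast v i = (v i ≢ F.zero) × (∀ j → i < j → v j ≡ F.zero)

InY : ∀ {n k} → Fin (suc k) → Fin (suc k) → Vertex n (suc k) → Set
InY {n} {k} s t v =
  ¬ IsZeroVertex v ×
  ModEq (suc k) (coordSum n v) (toℕ s) ×
  (∀ i → IsLast v i → v i ≡ t)

{-# OPTIONS --safe #-}
module Submission where

-- Let u, w be adjacent, differing exactly in coordinate i.  If u has a nonzero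
-- coordinate beyond i, then u and w share their last nonzero coordinate and its
-- value, forcing t₁ = t₂.  Otherwise both vanish beyond i, so u(i) ∈ {0, t₁} and
-- w(i) ∈ {0, t₂}, not both 0; exchanging coordinate i gives
-- s₁ + w(i) ≡ s₂ + u(i) (mod k), which in the three remaining cases is exactly
-- (i), (ii) or (iii).

open import Defs
open import Algebra.Properties.CommutativeSemigroup using (xy∙z≈zy∙x)
open import Data.Empty using (⊥-elim)
open import Data.Fin using (Fin; toℕ; _<_; _≤_; _<?_; _≟_)
import Data.Fin as F
open import Data.Fin.Properties using (any?; toℕ-injective; suc-injective; <-trans; <⇒≢)
open import Data.Nat using (ℕ; zero; suc; _+_; _%_; z≤n; s≤s; NonZero)
open import Data.Nat.DivMod using (%-distribˡ-+)
open import Data.Nat.Properties using (<-≤-trans; +-assoc; +-identityʳ; +-commutativeSemigroup)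
open import Data.Product using (Σ; ∃; _×_; _,_)
open import Data.Sum using (_⊎_; inj₁; inj₂; [_,_])
open import Function using (_∘_)
open import Relation.Binary.PropositionalEquality using (_≡_; _≢_; refl; sym; trans; cong; cong₂; subst; module ≡-Reasoning)
open import Relation.Nullary using (¬_; yes; no)
open import Relation.Nullary.Decidable using (¬?; _×-dec_; decidable-stable)

ZeroAfter : ∀ {n k} → Vertex n (suc k) → Fin n → Set
ZeroAfter v i = ∀ j → i < j → v j ≡ F.zero

AgreeOff : ∀ {n k} → Fin n → Vertex n k → Vertex n k → Set
AgreeOff i u w = ∀ j → j ≢ i → u j ≡ w j

zeroAfter⊎nonzeroAfter : ∀ {n k} (v : Vertex n (suc k)) i →
                         ZeroAfter v i ⊎ ∃ λ j → i < j × v j ≢ F.zero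
zeroAfter⊎nonzeroAfter v i with any? (λ j → (i <? j) ×-dec ¬? (v j ≟ F.zero))
... | yes nonzero = inj₂ nonzero
... | no ¬nonzero = inj₁ λ j i<j → decidable-stable (v j ≟ F.zero) (λ v≢0 → ¬nonzero (j , i<j , v≢0))

IsLast-suc : ∀ {n k} (v : Vertex (suc n) (suc k)) {l} → IsLast (v ∘ F.suc) l → IsLast v (F.suc l)
IsLast-suc v (v≢0 , after) = v≢0 , λ { (F.suc j) (s≤s l<j) → after j l<j }

IsLast-exists : ∀ {n k} (v : Vertex n (suc k)) j → v j ≢ F.zero → Σ (Fin n) λ l → IsLast v l × j ≤ l
IsLast-exists {suc n} v F.zero v≢0 with zeroAfter⊎nonzeroAfter v F.zero
... | inj₁ after = F.zero , (v≢0 , after) , z≤n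
... | inj₂ (F.suc j , _ , v≢0′) with IsLast-exists (v ∘ F.suc) j v≢0′
...   | l , last , _ = F.suc l , IsLast-suc v last , z≤n
IsLast-exists {suc n} v (F.suc j) v≢0 with IsLast-exists (v ∘ F.suc) j v≢0
... | l , last , j≤l = F.suc l , IsLast-suc v last , s≤s j≤l

AgreeOff-after : ∀ {n k} {u w : Vertex n k} {i j} → AgreeOff i u w → i < j → u j ≡ w j
AgreeOff-after agree i<j = agree _ (<⇒≢ i<j ∘ sym)

ZeroAfter-transfer : ∀ {n k} {u w : Vertex n (suc k)} {i} → AgreeOff i u w →
                     ZeroAfter u i → ZeroAfter w i
ZeroAfter-transfer agree after j i<j = trans (sym (AgreeOff-after agree i<j)) (after j i<j)

IsLast-transfer : ∀ {n k} {u w : Vertex n (suc k)} {i l} → AgreeOff i u w → i < l →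
                  IsLast u l → IsLast w l
IsLast-transfer agree i<l (u≢0 , after) =
  (λ w≡0 → u≢0 (trans (AgreeOff-after agree i<l) w≡0)) ,
  λ j l<j → trans (sym (AgreeOff-after agree (<-trans i<l l<j))) (after j l<j)

IsLast-shared : ∀ {n k} {u w : Vertex n (suc k)} {i j} → AgreeOff i u w → i < j → u j ≢ F.zero →
                Σ (Fin n) λ l → IsLast u l × IsLast w l × u l ≡ w l
IsLast-shared {u = u} {i = i} agree i<j uⱼ≢0 with IsLast-exists u _ uⱼ≢0
... | l , u-last , j≤l = l , u-last , IsLast-transfer agree i<l u-last , AgreeOff-after agree i<l
  where
  i<l : i < l
  i<l = <-≤-trans i<j j≤l

coord≡0⊎t : ∀ {n k t} {v : Vertex n (suc k)} i → (∀ l → IsLast v l → v l ≡ t) →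
            ZeroAfter v i → toℕ (v i) ≡ 0 ⊎ toℕ (v i) ≡ toℕ t
coord≡0⊎t {v = v} i last⇒t after with v i ≟ F.zero
... | yes v≡0 = inj₁ (cong toℕ v≡0)
... | no v≢0 = inj₂ (cong toℕ (last⇒t i (v≢0 , after)))

coordSum-cong : ∀ n {k} {u w : Vertex n k} → (∀ j → u j ≡ w j) → coordSum n u ≡ coordSum n w
coordSum-cong zero eq = refl
coordSum-cong (suc n) eq = cong₂ _+_ (cong toℕ (eq F.zero)) (coordSum-cong n (eq ∘ F.suc))

coordSum-exchange : ∀ n {k} (u w : Vertex n k) i → AgreeOff i u w →
                    coordSum n u + toℕ (w i) ≡ coordSum n w + toℕ (u i)
coordSum-exchange (suc n) u w F.zero agree =
  trans (xy∙z≈zy∙x +-commutativeSemigroup (toℕ (u F.zero)) _ (toℕ (w F.zero)))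
        (cong (λ S → toℕ (w F.zero) + S + toℕ (u F.zero))
              (coordSum-cong n (λ j → agree (F.suc j) λ ())))
coordSum-exchange (suc n) u w (F.suc i) agree = begin
  a + S + b    ≡⟨ +-assoc a S b ⟩
  a + (S + b)  ≡⟨ cong₂ _+_ (cong toℕ (agree F.zero λ ())) tail-exchange ⟩
  a′ + (S′ + c) ≡⟨ +-assoc a′ S′ c ⟨
  a′ + S′ + c  ∎
  where
  open ≡-Reasoning
  a = toℕ (u F.zero); a′ = toℕ (w F.zero); b = toℕ (w (F.suc i)); c = toℕ (u (F.suc i))
  S = coordSum n (u ∘ F.suc); S′ = coordSum n (w ∘ F.suc)
  tail-exchange : S + b ≡ S′ + c
  tail-exchange = coordSum-exchange n (u ∘ F.suc) (w ∘ F.suc) i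
                    (λ j j≢i → agree (F.suc j) (j≢i ∘ suc-injective))

%-cong-+ʳ : ∀ K .{{_ : NonZero K}} {a b} c → a % K ≡ b % K → (a + c) % K ≡ (b + c) % K
%-cong-+ʳ K {a} {b} c a≡b = begin
  (a + c) % K             ≡⟨ %-distribˡ-+ a c K ⟩
  (a % K + c % K) % K     ≡⟨ cong (λ x → (x + c % K) % K) a≡b ⟩
  (b % K + c % K) % K     ≡⟨ %-distribˡ-+ b c K ⟨
  (b + c) % K             ∎
  where open ≡-Reasoning

ModEq-exchange : ∀ {n m} {s₁ s₂ : Fin (suc m)} (u w : Vertex n (suc m)) i → AgreeOff i u w →
                 ModEq (suc m) (coordSum n u) (toℕ s₁) → ModEq (suc m) (coordSum n w) (toℕ s₂) →
                 ModEq (suc m) (toℕ s₁ + toℕ (w i)) (toℕ s₂ + toℕ (u i))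
ModEq-exchange {n} {m} {s₁} {s₂} u w i agree u≡s₁ w≡s₂ = begin
  (toℕ s₁ + toℕ (w i)) % K          ≡⟨ %-cong-+ʳ K {coordSum n u} {toℕ s₁} (toℕ (w i)) u≡s₁ ⟨
  (coordSum n u + toℕ (w i)) % K    ≡⟨ cong (_% K) (coordSum-exchange n u w i agree) ⟩
  (coordSum n w + toℕ (u i)) % K    ≡⟨ %-cong-+ʳ K {coordSum n w} {toℕ s₂} (toℕ (u i)) w≡s₂ ⟩
  (toℕ s₂ + toℕ (u i)) % K          ∎
  where open ≡-Reasoning; K = suc m

ModEq-exchange-cases : ∀ m {s₁ s₂ t₁ t₂ a b : ℕ} → a ≡ 0 ⊎ a ≡ t₁ → b ≡ 0 ⊎ b ≡ t₂ →
                 (a ≡ 0 → b ≢ 0) → ModEq (suc m) (s₁ + b) (s₂ + a) →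
                 ModEq (suc m) s₁ (s₂ + t₁) ⊎ ModEq (suc m) s₂ (s₁ + t₂) ⊎
                 ModEq (suc m) (s₁ + t₂) (s₂ + t₁)
ModEq-exchange-cases m (inj₁ refl) (inj₁ refl) a≡0⇒b≢0 _ = ⊥-elim (a≡0⇒b≢0 refl refl)
ModEq-exchange-cases m {s₁} (inj₂ refl) (inj₁ refl) _ eq =
  inj₁ (subst (λ x → x % suc m ≡ _) (+-identityʳ s₁) eq)
ModEq-exchange-cases m {s₂ = s₂} (inj₁ refl) (inj₂ refl) _ eq =
  inj₂ (inj₁ (sym (subst (λ x → _ ≡ x % suc m) (+-identityʳ s₂) eq)))
ModEq-exchange-cases m (inj₂ refl) (inj₂ refl) _ eq = inj₂ (inj₂ eq)

lemma14 : (n m : ℕ) → (s₁ s₂ t₁ t₂ : Fin (suc m)) →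
    t₁ ≢ F.zero → t₂ ≢ F.zero → t₁ ≢ t₂ →
    ¬ ModEq (suc m) (toℕ s₁) (toℕ s₂ + toℕ t₁) →
    ¬ ModEq (suc m) (toℕ s₂) (toℕ s₁ + toℕ t₂) →
    ¬ ModEq (suc m) (toℕ s₁ + toℕ t₂) (toℕ s₂ + toℕ t₁) →
    (u w : Vertex (suc n) (suc m)) →
    InY s₁ t₁ u → InY s₂ t₂ w → ¬ Adjacent u w
lemma14 n m s₁ s₂ t₁ t₂ _ _ t₁≢t₂ ¬i ¬ii ¬iii u w (_ , u≡s₁ , last-u) (_ , w≡s₂ , last-w)
        (i , uᵢ≢wᵢ , agree) with zeroAfter⊎nonzeroAfter u i
... | inj₁ u-after =
  [ ¬i , [ ¬ii , ¬iii ] ]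
    (ModEq-exchange-cases m {toℕ s₁} {toℕ s₂}
       (coord≡0⊎t i last-u u-after)
       (coord≡0⊎t i last-w (ZeroAfter-transfer agree u-after))
       (λ uᵢ≡0 wᵢ≡0 → uᵢ≢wᵢ (toℕ-injective (trans uᵢ≡0 (sym wᵢ≡0))))
       (ModEq-exchange {s₁ = s₁} {s₂} u w i agree u≡s₁ w≡s₂))
... | inj₂ (j , i<j , uⱼ≢0) with IsLast-shared agree i<j uⱼ≢0
...   | l , u-last , w-last , uₗ≡wₗ =
  t₁≢t₂ (trans (sym (last-u l u-last)) (trans uₗ≡wₗ (last-w l w-last)))
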